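{- Let $\mathcal{M}_0$ be the set of matrices in $\mathcal{M}$ with $d_1=0$, let $\mathcal{O}$ be the set of all partitions into distinct odd parts greater than $1$ that arise by applying the Path Procedure to matrices in $\mathcal{M}$, and let $\mathcal{T}$ be the set of all $t$-squared partitions (over all $t\ge 1$), recorded as non-increasing tuples $(c_1,\ldots,c_t)$ of positive integers. Then there is a one-to-one correspondence between $\mathcal{M}_0$, $\mathcal{O}$ and $\mathcal{T}$: the map sending $M\in\mathcal{M}_0$ to its Path Procedure partition is a bijection $\mathcal{M}_0\to\mathcal{O}$, and the map sending $M=\begin{pmatrix} c_1 & \cdots & c_{s-1} & 0\\ 0 & d_2 & \cdots & d_s\end{pmatrix}\in\mathcal{M}_0$ to the $t$-squared partition with $t=s-1$ and parts $(c_1,\ldots,c_{s-1})$, i.e. $P(M)=(c_1+\cdots+c_{s-1})^2+2(c_1^2+\cdots+c_{s-1}^2)$, is a bijection $\mathcal{M}_0\to\mathcal{T}$.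
   Context: $\mathcal{M}$ is the set of all two-line matrices $M=\begin{pmatrix} c_1 & \cdots & c_s\\ d_1 & \cdots & d_s\end{pmatrix}$ ($s\ge1$) with non-negative integer entries satisfying $c_s=0$, $d_s\ne0$, and $c_j=c_{j+1}+d_{j+1}$ for $1\le j\le s-1$. With $\ell(M)$ the sum of all entries and $N=\ell(M)-d_1$, the Path Procedure associates to $M$ the partition whose parts are $$\lambda_{k,i}=2\Big(N-(d_2+\cdots+d_k)-(c_1+\cdots+c_{k-1})-i\Big)-1,\quad k=1,\ldots,s-1,\ i=0,\ldots,c_k-1,$$ and $P(M)$ is the sum of these parts. A $t$-squared partition of a positive integer $m$ is a representation $m=b^2+2(c_1^2+\cdots+c_t^2)$ with $b=c_1+\cdots+c_t$ and $c_1,\ldots,c_t$ positive integers. -}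

module Defs where

open import Data.Nat using (ℕ; zero; suc; _+_; _*_; _∸_; _≤_; _<_; _≥_; _>_)
open import Data.Product using (_×_; _,_; proj₁; proj₂; ∃)
open import Data.List using (List; []; _∷_; map; length; concatMap; upTo)
open import Data.Nat.ListAction using (sum)
open import Data.List.Relation.Unary.All using (All)
open import Data.List.Relation.Unary.Linked using (Linked)
open import Data.Empty using (⊥)
open import Relation.Nullary using (¬_)
open import Relation.Binary.PropositionalEquality using (_≡_)

-- A two-line matrix is the list of its columns (c_j , d_j), j = 1..s.
Mat : Set
Mat = List (ℕ × ℕ)

InM : Mat → Set
InM [] = ⊥
InM ((c , d) ∷ []) = (c ≡ 0) × ¬ (d ≡ 0)
InM ((c , d) ∷ (c' , d') ∷ rest) = (c ≡ c' + d') × InM ((c' , d') ∷ rest)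

-- 1-based entry access (0 outside the range 1..s).
col : Mat → ℕ → ℕ × ℕ
col [] _ = 0 , 0
col (x ∷ xs) zero = 0 , 0
col (x ∷ xs) (suc zero) = x
col (x ∷ xs) (suc (suc j)) = col xs (suc j)

cAt : Mat → ℕ → ℕ
cAt M j = proj₁ (col M j)

dAt : Mat → ℕ → ℕ
dAt M j = proj₂ (col M j)

InM0 : Mat → Set
InM0 M = InM M × (dAt M 1 ≡ 0)

-- sumFromTo f a b = f a + f (a+1) + ... + f b  (0 if b < a)
sumFromTo : (ℕ → ℕ) → ℕ → ℕ → ℕ
sumFromTo f a b = sum (map (λ i → f (a + i)) (upTo (suc b ∸ a)))

ell : Mat → ℕ
ell M = sum (map (λ x → proj₁ x + proj₂ x) M)

Nof : Mat → ℕ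
Nof M = ell M ∸ dAt M 1

-- The part λ_{k,i} = 2(N − (d_2+⋯+d_k) − (c_1+⋯+c_{k−1}) − i) − 1.
-- (All subtractions are non-negative for M ∈ 𝓜, so truncated ∸ is exact.)
lam : Mat → ℕ → ℕ → ℕ
lam M k i = 2 * (Nof M ∸ sumFromTo (dAt M) 2 k ∸ sumFromTo (cAt M) 1 (k ∸ 1) ∸ i) ∸ 1

-- The Path Procedure partition, listed in the order k = 1..s−1, i = 0..c_k−1
-- (this order is strictly decreasing for M ∈ 𝓜).
pathPartition : Mat → List ℕ
pathPartition M =
  concatMap (λ k → map (lam M k) (upTo (cAt M k)))
            (map suc (upTo (length M ∸ 1)))

P : Mat → ℕ
P M = sum (pathPartition M)

topInit : Mat → List ℕ
topInit M = map (λ k → cAt M (suc k)) (upTo (length M ∸ 1))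

Odd : ℕ → Set
Odd n = ∃ λ k → n ≡ suc (2 * k)

InO : List ℕ → Set
InO p = ¬ (p ≡ [])
      × Linked _>_ p
      × All (λ x → Odd x × 1 < x) p
      × ∃ λ M → InM M × pathPartition M ≡ p

TSquared : ℕ → List ℕ → Set
TSquared m cs = ¬ (cs ≡ [])
              × All (λ c → 1 ≤ c) cs
              × Linked _≥_ cs
              × m ≡ sum cs * sum cs + 2 * sum (map (λ c → c * c) cs)

module Submission where

-- The key observation is that the Path Procedure only depends on the top
-- row (c₁, …, c_{s−1}) of a matrix M ∈ 𝓜: writing S_k = c_k + ⋯ + c_{s−1},
-- the k-th block of parts is the run of c_k consecutive odd numbers
-- 2(S_k + c_k) − 1 > ⋯ > 2 S_k + 1  (lemma pathPartition≡runsOf).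
-- Next, a matrix of 𝓜 is determined by d₁ and its top row, and every
-- positive non-increasing row arises (fromTopRow, reconstruct); so 𝓜₀ is
-- in bijection with positive non-increasing non-empty rows.
-- Finally runsOf is studied on such rows: it is strictly decreasing, made of
-- odd parts > 1, injective, and its sum is (Σ c)² + 2 Σ c², since a run of c
-- odd numbers above 2B sums to (B + c)² − B².

open import Defs
open import Data.Nat using (ℕ; zero; suc; _+_; _*_; _∸_; _≤_; _<_; _≥_; _>_; z≤n; s≤s)
open import Data.Nat.Properties
open import Data.Product using (_×_; _,_; proj₁; ∃)
open import Data.Maybe using (just)
open import Data.Maybe.Relation.Binary.Connected using (Connected; just; just-nothing)
open import Data.List using (List; []; _∷_; _++_; map; length; head; upTo; concatMap)
open import Data.List.Properties using (map-applyUpTo; map-cong; concatMap-map; concatMap-cong; ∷-injectiveˡ; ++-cancelˡ; length-++)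
open import Data.Nat.ListAction using (sum)
open import Data.Nat.ListAction.Properties using (sum-++)
open import Data.List.Relation.Unary.All using (All; []; _∷_)
open import Data.List.Relation.Unary.All.Properties using (++⁺)
open import Data.List.Relation.Unary.Linked using (Linked; []; [-]; _∷_; _∷′_)
open import Data.Empty using (⊥-elim)
open import Relation.Nullary using (¬_)
open import Function using (_∘_; id)
open import Relation.Binary.PropositionalEquality
open import Data.Nat.Tactic.RingSolver using (solve-∀)

map-upTo-suc : ∀ {A : Set} (f : ℕ → A) n → map f (upTo (suc n)) ≡ f 0 ∷ map (f ∘ suc) (upTo n)
map-upTo-suc f n = trans (map-applyUpTo id f (suc n)) (cong (f 0 ∷_) (sym (map-applyUpTo id (f ∘ suc) n)))

-- The top row (c₁, …, c_{s−1}) computed by recursion on the columns; it is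
-- the list topInit of the statement, in a form that reduces on cons cells.
topRow : Mat → List ℕ
topRow []                = []
topRow (_ ∷ [])          = []
topRow (col₁ ∷ col₂ ∷ R) = proj₁ col₁ ∷ topRow (col₂ ∷ R)

topInit≡topRow : ∀ M → topInit M ≡ topRow M
topInit≡topRow []                = refl
topInit≡topRow (_ ∷ [])          = refl
topInit≡topRow (col₁ ∷ col₂ ∷ R) =
  trans (map-upTo-suc _ (length R)) (cong (proj₁ col₁ ∷_) (topInit≡topRow (col₂ ∷ R)))

-- Telescoping c_j = c_{j+1} + d_{j+1}: below a first column (c, d) of a
-- matrix in 𝓜, the remaining entries sum to c + (c₂ + ⋯ + c_{s−1}).
ell-tail : ∀ c d R → InM ((c , d) ∷ R) → ell R ≡ c + sum (topRow R)
ell-tail c d [] (c≡0 , _) = sym (trans (+-identityʳ c) c≡0)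
ell-tail c d ((c′ , d′) ∷ []) (c≡ , _) = cong (_+ 0) (sym c≡)
ell-tail c d ((c′ , d′) ∷ next ∷ R) (c≡ , inM) = begin
  (c′ + d′) + ell (next ∷ R)                  ≡⟨ cong ((c′ + d′) +_) (ell-tail c′ d′ (next ∷ R) inM) ⟩
  (c′ + d′) + (c′ + sum (topRow (next ∷ R)))  ≡⟨ cong (_+ (c′ + sum (topRow (next ∷ R)))) (sym c≡) ⟩
  c + (c′ + sum (topRow (next ∷ R)))          ∎
  where open ≡-Reasoning

oddBelow : ℕ → ℕ → ℕ
oddBelow A i = 2 * (A ∸ i) ∸ 1

N-first : ∀ c d W → (c + d) + W ∸ d ≡ c + W
N-first c d W = trans (cong (_∸ d) (swap c d W)) (m+n∸n≡m (c + W) d)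
  where
  swap : ∀ c d W → (c + d) + W ≡ (c + W) + d
  swap = solve-∀

-- The offset of a part λ_{k+1,i} of M equals that of λ_{k,i} of M with its
-- first column removed: the extra c₁ and d₂ it subtracts are exactly what
-- N(M) exceeds N of the shorter matrix by.
N-shift : ∀ c d W d′ X Y → ((c + d) + W ∸ d) ∸ (d′ + X) ∸ (c + Y) ≡ (W ∸ d′) ∸ X ∸ Y
N-shift c d W d′ X Y = begin
  ((c + d) + W ∸ d) ∸ (d′ + X) ∸ (c + Y) ≡⟨ cong (λ z → z ∸ (d′ + X) ∸ (c + Y)) (N-first c d W) ⟩
  (c + W) ∸ (d′ + X) ∸ (c + Y)           ≡⟨ ∸-+-assoc (c + W) (d′ + X) (c + Y) ⟩
  (c + W) ∸ ((d′ + X) + (c + Y))         ≡⟨ cong ((c + W) ∸_) (regroup c (d′ + X) Y) ⟩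
  (c + W) ∸ (c + ((d′ + X) + Y))         ≡⟨ [m+n]∸[m+o]≡n∸o c W ((d′ + X) + Y) ⟩
  W ∸ ((d′ + X) + Y)                     ≡⟨ sym (∸-+-assoc W (d′ + X) Y) ⟩
  W ∸ (d′ + X) ∸ Y                       ≡⟨ cong (_∸ Y) (sym (∸-+-assoc W d′ X)) ⟩
  (W ∸ d′) ∸ X ∸ Y                       ∎
  where
  open ≡-Reasoning
  regroup : ∀ c u Y → u + (c + Y) ≡ c + (u + Y)
  regroup = solve-∀

pathPartition-peel : ∀ c d c′ d′ R →
  pathPartition ((c , d) ∷ (c′ , d′) ∷ R)
    ≡ map (oddBelow (c + ell ((c′ , d′) ∷ R))) (upTo c) ++ pathPartition ((c′ , d′) ∷ R)
pathPartition-peel c d c′ d′ R = begin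
  pathPartition M
    ≡⟨ cong (concatMap (block M)) (map-upTo-suc suc (length R)) ⟩
  block M 1 ++ concatMap (block M) (map (suc ∘ suc) (upTo (length R)))
    ≡⟨ cong₂ _++_ (map-cong (λ i → cong (λ A → oddBelow A i) (N-first c d W)) (upTo c)) shifted ⟩
  map (oddBelow (c + W)) (upTo c) ++ pathPartition R₁ ∎
  where
  open ≡-Reasoning
  M  = (c , d) ∷ (c′ , d′) ∷ R
  R₁ = (c′ , d′) ∷ R
  W  = ell R₁
  block : Mat → ℕ → List ℕ
  block N k = map (lam N k) (upTo (cAt N k))
  d-sums : ∀ k → sumFromTo (dAt M) 2 (suc (suc k)) ≡ d′ + sumFromTo (dAt R₁) 2 (suc k)
  d-sums k = cong sum (map-upTo-suc (λ i → dAt M (2 + i)) k)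
  c-sums : ∀ k → sumFromTo (cAt M) 1 (suc k) ≡ c + sumFromTo (cAt R₁) 1 k
  c-sums k = cong sum (map-upTo-suc (λ i → cAt M (1 + i)) k)
  lam-shift : ∀ k i → lam M (suc (suc k)) i ≡ lam R₁ (suc k) i
  lam-shift k i = cong (λ A → oddBelow A i) (begin
    Nof M ∸ sumFromTo (dAt M) 2 (suc (suc k)) ∸ sumFromTo (cAt M) 1 (suc k)
      ≡⟨ cong₂ (λ x y → Nof M ∸ x ∸ y) (d-sums k) (c-sums k) ⟩
    Nof M ∸ (d′ + sumFromTo (dAt R₁) 2 (suc k)) ∸ (c + sumFromTo (cAt R₁) 1 k)
      ≡⟨ N-shift c d W d′ (sumFromTo (dAt R₁) 2 (suc k)) (sumFromTo (cAt R₁) 1 k) ⟩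
    Nof R₁ ∸ sumFromTo (dAt R₁) 2 (suc k) ∸ sumFromTo (cAt R₁) 1 k ∎)
  shifted : concatMap (block M) (map (suc ∘ suc) (upTo (length R))) ≡ pathPartition R₁
  shifted = trans (concatMap-map (block M) (suc ∘ suc) (upTo (length R)))
    (trans (concatMap-cong (λ k → map-cong (lam-shift k) (upTo (cAt R₁ (suc k)))) (upTo (length R)))
      (sym (concatMap-map (block R₁) suc (upTo (length R)))))

oddRun : ℕ → ℕ → List ℕ
oddRun B zero    = []
oddRun B (suc c) = suc (2 * (B + c)) ∷ oddRun B c

runsOf : List ℕ → List ℕ
runsOf []       = []
runsOf (c ∷ cs) = oddRun (c + sum cs) c ++ runsOf cs

double-suc∸1 : ∀ x → 2 * suc x ∸ 1 ≡ suc (2 * x)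
double-suc∸1 x = +-suc x (x + 0)

oddBelow-run : ∀ B c → map (oddBelow (B + c)) (upTo c) ≡ oddRun B c
oddBelow-run B zero    = refl
oddBelow-run B (suc c) = begin
  map (oddBelow (B + suc c)) (upTo (suc c))             ≡⟨ cong (λ A → map (oddBelow A) (upTo (suc c))) (+-suc B c) ⟩
  map (oddBelow (suc (B + c))) (upTo (suc c))           ≡⟨ map-upTo-suc (oddBelow (suc (B + c))) c ⟩
  oddBelow (suc (B + c)) 0 ∷ map (oddBelow (B + c)) (upTo c) ≡⟨ cong₂ _∷_ (double-suc∸1 (B + c)) (oddBelow-run B c) ⟩
  oddRun B (suc c)                                      ∎
  where open ≡-Reasoning

pathPartition≡runsOf : ∀ M → InM M → pathPartition M ≡ runsOf (topRow M)
pathPartition≡runsOf ((c , d) ∷ []) _ = refl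
pathPartition≡runsOf ((c , d) ∷ (c′ , d′) ∷ R) (c≡ , inM) = begin
  pathPartition ((c , d) ∷ R₁)                                  ≡⟨ pathPartition-peel c d c′ d′ R ⟩
  map (oddBelow (c + ell R₁)) (upTo c) ++ pathPartition R₁      ≡⟨ cong₂ _++_ firstBlock (pathPartition≡runsOf ((c′ , d′) ∷ R) inM) ⟩
  oddRun (c + sum (topRow R₁)) c ++ runsOf (topRow R₁)          ∎
  where
  open ≡-Reasoning
  R₁ = (c′ , d′) ∷ R
  N≡ : c + ell R₁ ≡ (c + sum (topRow R₁)) + c
  N≡ = trans (cong (c +_) (ell-tail c d R₁ (c≡ , inM))) (+-comm c (c + sum (topRow R₁)))
  firstBlock : map (oddBelow (c + ell R₁)) (upTo c) ≡ oddRun (c + sum (topRow R₁)) c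
  firstBlock = trans (cong (λ A → map (oddBelow A) (upTo c)) N≡) (oddBelow-run (c + sum (topRow R₁)) c)

Admissible : List ℕ → Set
Admissible cs = All (1 ≤_) cs × Linked _≥_ cs

-- c_j = c_{j+1} + d_{j+1} with d_s ≠ 0 and c_s = 0 forces c_j ≥ c_{j+1} and c_{s−1} ≥ 1.
topRow-admissible : ∀ M → InM M → Admissible (topRow M)
topRow-admissible (_ ∷ []) _ = [] , []
topRow-admissible ((c , d) ∷ (c′ , d′) ∷ []) (c≡ , c′≡0 , d′≢0) =
  subst (1 ≤_) (sym (trans c≡ (cong (_+ d′) c′≡0))) (n≢0⇒n>0 d′≢0) ∷ [] , [-]
topRow-admissible ((c , d) ∷ (c′ , d′) ∷ next ∷ R) (c≡ , inM)
  with topRow-admissible ((c′ , d′) ∷ next ∷ R) inM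
... | (1≤c′ ∷ pos) , dec = (≤-trans 1≤c′ c′≤c ∷ 1≤c′ ∷ pos) , (c′≤c ∷ dec)
  where
  c′≤c : c′ ≤ c
  c′≤c = subst (c′ ≤_) (sym c≡) (m≤m+n c′ d′)

-- d₁ = 0 rules out the one-column matrix (0, d₁) with d₁ ≠ 0, so 𝓜₀ has non-empty top rows.
topRow-nonempty : ∀ M → InM0 M → ¬ topRow M ≡ []
topRow-nonempty ((c , d) ∷ []) ((_ , d≢0) , d≡0) _ = d≢0 d≡0
topRow-nonempty (_ ∷ _ ∷ _) _ ()

-- First entry of a row, 0 for the empty row (= c_s).
head₀ : List ℕ → ℕ
head₀ []      = 0
head₀ (c ∷ _) = c

-- The matrix with first bottom entry d and top row cs: d_{j+1} = c_j − c_{j+1}.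
fromTopRow : ℕ → List ℕ → Mat
fromTopRow d []       = (0 , d) ∷ []
fromTopRow d (c ∷ cs) = (c , d) ∷ fromTopRow (c ∸ head₀ cs) cs

topRow-fromTopRow : ∀ d cs → topRow (fromTopRow d cs) ≡ cs
topRow-fromTopRow d []            = refl
topRow-fromTopRow d (c ∷ [])      = refl
topRow-fromTopRow d (c ∷ c′ ∷ cs) = cong (c ∷_) (topRow-fromTopRow (c ∸ c′) (c′ ∷ cs))

fromTopRow-InM : ∀ d c cs → Admissible (c ∷ cs) → InM (fromTopRow d (c ∷ cs))
fromTopRow-InM d c [] (1≤c ∷ _ , _) = refl , refl , λ c≡0 → 1+n≰n (subst (1 ≤_) c≡0 1≤c)
fromTopRow-InM d c (c′ ∷ cs) (_ ∷ pos , c′≤c ∷ dec) =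
  sym (m+[n∸m]≡n c′≤c) , fromTopRow-InM (c ∸ c′) c′ cs (pos , dec)

fromTopRow-InM0 : ∀ cs → Admissible cs → ¬ cs ≡ [] → InM0 (fromTopRow 0 cs)
fromTopRow-InM0 []       _   nonempty = ⊥-elim (nonempty refl)
fromTopRow-InM0 (c ∷ cs) adm _        = fromTopRow-InM 0 c cs adm , refl

topRow-head : ∀ c d R → InM ((c , d) ∷ R) → head₀ (topRow ((c , d) ∷ R)) ≡ c
topRow-head c d []      (c≡0 , _) = sym c≡0
topRow-head c d (_ ∷ _) _         = refl

reconstruct : ∀ M → InM M → M ≡ fromTopRow (dAt M 1) (topRow M)
reconstruct ((c , d) ∷ []) (c≡0 , _) = cong (λ x → (x , d) ∷ []) c≡0
reconstruct ((c , d) ∷ (c′ , d′) ∷ R) (c≡ , inM) = cong ((c , d) ∷_) (begin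
  (c′ , d′) ∷ R                                  ≡⟨ reconstruct ((c′ , d′) ∷ R) inM ⟩
  fromTopRow d′ (topRow ((c′ , d′) ∷ R))        ≡⟨ cong (λ x → fromTopRow x (topRow ((c′ , d′) ∷ R))) d′≡ ⟩
  fromTopRow (c ∸ head₀ (topRow ((c′ , d′) ∷ R))) (topRow ((c′ , d′) ∷ R)) ∎)
  where
  open ≡-Reasoning
  d′≡ : d′ ≡ c ∸ head₀ (topRow ((c′ , d′) ∷ R))
  d′≡ = sym (trans (cong₂ _∸_ c≡ (topRow-head c′ d′ R inM)) (m+n∸m≡n c′ d′))

InM-unique : ∀ M M′ → InM M → InM M′ → dAt M 1 ≡ dAt M′ 1 → topRow M ≡ topRow M′ → M ≡ M′
InM-unique M M′ inM inM′ d≡ row≡ =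
  trans (reconstruct M inM) (trans (cong₂ fromTopRow d≡ row≡) (sym (reconstruct M′ inM′)))

-- `Above b xs`: b exceeds the first element of xs, so b ∷ xs keeps a
-- strictly decreasing list strictly decreasing.
Above : ℕ → List ℕ → Set
Above b xs = Connected _>_ (just b) (head xs)

Above-mono : ∀ {a b} xs → a ≤ b → Above a xs → Above b xs
Above-mono []      _   just-nothing = just-nothing
Above-mono (_ ∷ _) a≤b (just x<a)   = just (<-≤-trans x<a a≤b)

oddRun-decreasing : ∀ B c xs → Linked _>_ xs → Above (suc (2 * B)) xs →
  Linked _>_ (oddRun B c ++ xs) × Above (suc (2 * (B + c))) (oddRun B c ++ xs)
oddRun-decreasing B zero xs dec above =
  dec , subst (λ b → Above (suc (2 * b)) xs) (sym (+-identityʳ B)) above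
oddRun-decreasing B (suc c) xs dec above with oddRun-decreasing B c xs dec above
... | dec′ , above′ = above′ ∷′ dec′ , just next-odd
  where
  next-odd : suc (2 * (B + c)) < suc (2 * (B + suc c))
  next-odd = subst (λ x → suc (2 * (B + c)) < suc (2 * x)) (sym (+-suc B c)) (s≤s (*-monoʳ-< 2 (n<1+n (B + c))))

runsOf-bounded : ∀ c cs → Linked _≥_ (c ∷ cs) →
  Linked _>_ (runsOf cs) × Above (suc (2 * (c + sum cs))) (runsOf cs)
runsOf-bounded c [] _ = [] , just-nothing
runsOf-bounded c (c′ ∷ cs) (c′≤c ∷ dec)
  with runsOf-bounded c′ cs dec
... | dec′ , above′ with oddRun-decreasing (c′ + sum cs) c′ (runsOf cs) dec′ above′
... | dec″ , above″ = dec″ , Above-mono (runsOf (c′ ∷ cs)) (s≤s (*-monoʳ-≤ 2 run-top≤)) above″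
  where
  run-top≤ : (c′ + sum cs) + c′ ≤ c + (c′ + sum cs)
  run-top≤ = subst (_≤ c + (c′ + sum cs)) (+-comm c′ (c′ + sum cs)) (+-monoˡ-≤ (c′ + sum cs) c′≤c)

runsOf-decreasing : ∀ cs → Linked _≥_ cs → Linked _>_ (runsOf cs)
runsOf-decreasing []       _   = []
runsOf-decreasing (c ∷ cs) dec = proj₁ (runsOf-bounded c (c ∷ cs) (≤-refl ∷ dec))

OddPart : ℕ → Set
OddPart x = Odd x × 1 < x

oddRun-odd : ∀ B c → 1 ≤ B → All OddPart (oddRun B c)
oddRun-odd B zero    _   = []
oddRun-odd B (suc c) 1≤B =
  ((B + c , refl) , s≤s (≤-trans 1≤B (≤-trans (m≤m+n B c) (m≤m+n (B + c) _)))) ∷ oddRun-odd B c 1≤B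

runsOf-odd : ∀ cs → All (1 ≤_) cs → All OddPart (runsOf cs)
runsOf-odd []       _           = []
runsOf-odd (c ∷ cs) (1≤c ∷ pos) = ++⁺ (oddRun-odd (c + sum cs) c (≤-trans 1≤c (m≤m+n c (sum cs)))) (runsOf-odd cs pos)

runsOf-nonempty : ∀ cs → All (1 ≤_) cs → ¬ cs ≡ [] → ¬ runsOf cs ≡ []
runsOf-nonempty []            _             nonempty _ = nonempty refl
runsOf-nonempty (suc c ∷ cs) (s≤s z≤n ∷ _) _ ()

oddRun-length : ∀ B c → length (oddRun B c) ≡ c
oddRun-length B zero    = refl
oddRun-length B (suc c) = cong suc (oddRun-length B c)

runsOf-length : ∀ cs → length (runsOf cs) ≡ sum cs
runsOf-length []       = refl
runsOf-length (c ∷ cs) = trans (length-++ (oddRun (c + sum cs) c)) (cong₂ _+_ (oddRun-length _ c) (runsOf-length cs))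

-- A positive row is recovered from its partition: the number of parts gives
-- S = c₁ + ⋯ + c_t, the largest part 2(S + c₁) − 1 then gives c₁, and the
-- rest is the partition of the remaining row.
runsOf-injective : ∀ cs cs′ → All (1 ≤_) cs → All (1 ≤_) cs′ → runsOf cs ≡ runsOf cs′ → cs ≡ cs′
runsOf-injective []           []             _ _ _ = refl
runsOf-injective []           (suc _ ∷ _)    _ (s≤s z≤n ∷ _) ()
runsOf-injective (suc _ ∷ _)  []             (s≤s z≤n ∷ _) _ ()
runsOf-injective (suc c ∷ cs) (suc c′ ∷ cs′) (s≤s z≤n ∷ pos) (s≤s z≤n ∷ pos′) runs≡ =
  cong₂ _∷_ (cong suc c≡) (runsOf-injective cs cs′ pos pos′ (++-cancelˡ (oddRun S (suc c)) (runsOf cs) (runsOf cs′) tails≡))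
  where
  S  = suc c + sum cs
  S′ = suc c′ + sum cs′
  S≡ : S ≡ S′
  S≡ = trans (sym (runsOf-length (suc c ∷ cs))) (trans (cong length runs≡) (runsOf-length (suc c′ ∷ cs′)))
  largest≡ : S + c ≡ S′ + c′
  largest≡ = *-cancelˡ-≡ (S + c) (S′ + c′) 2 (suc-injective (∷-injectiveˡ runs≡))
  c≡ : c ≡ c′
  c≡ = +-cancelˡ-≡ S c c′ (trans largest≡ (cong (_+ c′) (sym S≡)))
  tails≡ : oddRun S (suc c) ++ runsOf cs ≡ oddRun S (suc c) ++ runsOf cs′
  tails≡ = trans runs≡ (cong₂ (λ B n → oddRun B (suc n) ++ runsOf cs′) (sym S≡) (sym c≡))

oddRun-sum : ∀ B c → sum (oddRun B c) + B * B ≡ (B + c) * (B + c)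
oddRun-sum B zero    = cong (λ x → x * x) (sym (+-identityʳ B))
oddRun-sum B (suc c) = begin
  (suc (2 * (B + c)) + sum (oddRun B c)) + B * B ≡⟨ +-assoc (suc (2 * (B + c))) (sum (oddRun B c)) (B * B) ⟩
  suc (2 * (B + c)) + (sum (oddRun B c) + B * B) ≡⟨ cong (suc (2 * (B + c)) +_) (oddRun-sum B c) ⟩
  suc (2 * (B + c)) + (B + c) * (B + c)          ≡⟨ next-square (B + c) ⟩
  suc (B + c) * suc (B + c)                      ≡⟨ cong (λ x → x * x) (sym (+-suc B c)) ⟩
  (B + suc c) * (B + suc c)                      ∎
  where
  open ≡-Reasoning
  next-square : ∀ x → suc (2 * x) + x * x ≡ suc x * suc x
  next-square = solve-∀

runsOf-sum : ∀ cs → sum (runsOf cs) ≡ sum cs * sum cs + 2 * sum (map (λ c → c * c) cs)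
runsOf-sum []       = refl
runsOf-sum (c ∷ cs) = begin
  sum (oddRun B c ++ runsOf cs)          ≡⟨ sum-++ (oddRun B c) (runsOf cs) ⟩
  sum (oddRun B c) + sum (runsOf cs)     ≡⟨ cong (sum (oddRun B c) +_) (runsOf-sum cs) ⟩
  sum (oddRun B c) + (S * S + 2 * Q)     ≡⟨ +-cancelʳ-≡ (B * B) _ _ (begin
      sum (oddRun B c) + (S * S + 2 * Q) + B * B   ≡⟨ move-square (sum (oddRun B c)) (B * B) (S * S + 2 * Q) ⟩
      (sum (oddRun B c) + B * B) + (S * S + 2 * Q) ≡⟨ cong (_+ (S * S + 2 * Q)) (oddRun-sum B c) ⟩
      (B + c) * (B + c) + (S * S + 2 * Q)          ≡⟨ expand c S Q ⟩
      ((c + S) * (c + S) + 2 * (c * c + Q)) + B * B ∎) ⟩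
  (c + S) * (c + S) + 2 * (c * c + Q)    ∎
  where
  open ≡-Reasoning
  S = sum cs
  B = c + S
  Q = sum (map (λ c → c * c) cs)
  move-square : ∀ x y z → x + z + y ≡ (x + y) + z
  move-square = solve-∀
  expand : ∀ c S Q → ((c + S) + c) * ((c + S) + c) + (S * S + 2 * Q) ≡ ((c + S) * (c + S) + 2 * (c * c + Q)) + (c + S) * (c + S)
  expand = solve-∀

pathPartition-InO : ∀ M → InM0 M → InO (pathPartition M)
pathPartition-InO M (inM , d₁≡0) with topRow-admissible M inM
... | pos , dec = subst InO (sym closed)
  ( runsOf-nonempty (topRow M) pos (topRow-nonempty M (inM , d₁≡0))
  , runsOf-decreasing (topRow M) dec
  , runsOf-odd (topRow M) pos
  , M , inM , closed )
  where
  closed : pathPartition M ≡ runsOf (topRow M)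
  closed = pathPartition≡runsOf M inM

pathPartition-fromTopRow : ∀ cs → Admissible cs → ¬ cs ≡ [] → pathPartition (fromTopRow 0 cs) ≡ runsOf cs
pathPartition-fromTopRow cs adm nonempty =
  trans (pathPartition≡runsOf _ (proj₁ (fromTopRow-InM0 cs adm nonempty))) (cong runsOf (topRow-fromTopRow 0 cs))

corollary3p3 : ((M : Mat) → InM0 M → InO (pathPartition M))
    × ((M M' : Mat) → InM0 M → InM0 M' → pathPartition M ≡ pathPartition M' → M ≡ M')
    × ((p : List ℕ) → InO p → ∃ λ M → InM0 M × pathPartition M ≡ p)
    × ((M : Mat) → InM0 M → TSquared (P M) (topInit M))
    × ((M M' : Mat) → InM0 M → InM0 M' → P M ≡ P M' → topInit M ≡ topInit M' → M ≡ M')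
    × ((m : ℕ) (cs : List ℕ) → TSquared m cs → ∃ λ M → InM0 M × P M ≡ m × topInit M ≡ cs)
corollary3p3 = pathPartition-InO , injective-O , onto-O , to-T , injective-T , onto-T
  where
  -- equal partitions ⇒ equal top rows (runsOf is injective) ⇒ equal matrices (d₁ = 0 for both)
  injective-O : (M M′ : Mat) → InM0 M → InM0 M′ → pathPartition M ≡ pathPartition M′ → M ≡ M′
  injective-O M M′ (inM , d₁≡0) (inM′ , d₁′≡0) parts≡ =
    InM-unique M M′ inM inM′ (trans d₁≡0 (sym d₁′≡0))
      (runsOf-injective (topRow M) (topRow M′) (proj₁ (topRow-admissible M inM)) (proj₁ (topRow-admissible M′ inM′))
        (trans (sym (pathPartition≡runsOf M inM)) (trans parts≡ (pathPartition≡runsOf M′ inM′))))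
  -- p comes from some M ∈ 𝓜; replacing d₁ by 0 keeps the top row, hence the partition
  onto-O : (p : List ℕ) → InO p → ∃ λ M → InM0 M × pathPartition M ≡ p
  onto-O p (p≢[] , _ , _ , M , inM , parts≡) =
    fromTopRow 0 (topRow M) , fromTopRow-InM0 (topRow M) adm row≢[] ,
    trans (pathPartition-fromTopRow (topRow M) adm row≢[]) (trans (sym (pathPartition≡runsOf M inM)) parts≡)
    where
    adm = topRow-admissible M inM
    row≢[] : ¬ topRow M ≡ []
    row≢[] row≡[] = p≢[] (trans (sym parts≡) (trans (pathPartition≡runsOf M inM) (cong runsOf row≡[])))
  to-T : (M : Mat) → InM0 M → TSquared (P M) (topInit M)
  to-T M inM0@(inM , _) rewrite topInit≡topRow M with topRow-admissible M inM
  ... | pos , dec = topRow-nonempty M inM0 , pos , dec ,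
    trans (cong sum (pathPartition≡runsOf M inM)) (runsOf-sum (topRow M))
  injective-T : (M M′ : Mat) → InM0 M → InM0 M′ → P M ≡ P M′ → topInit M ≡ topInit M′ → M ≡ M′
  injective-T M M′ (inM , d₁≡0) (inM′ , d₁′≡0) _ row≡ =
    InM-unique M M′ inM inM′ (trans d₁≡0 (sym d₁′≡0)) (trans (sym (topInit≡topRow M)) (trans row≡ (topInit≡topRow M′)))
  onto-T : (m : ℕ) (cs : List ℕ) → TSquared m cs → ∃ λ M → InM0 M × P M ≡ m × topInit M ≡ cs
  onto-T m cs (cs≢[] , pos , dec , m≡) =
    fromTopRow 0 cs , fromTopRow-InM0 cs (pos , dec) cs≢[] ,
    trans (cong sum (pathPartition-fromTopRow cs (pos , dec) cs≢[])) (trans (runsOf-sum cs) (sym m≡)) ,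
    trans (topInit≡topRow (fromTopRow 0 cs)) (topRow-fromTopRow 0 cs)
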